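{- Let $a,b,d$ be real constants and let $(C_n)_{n\ge 0}$ be the sequence defined by $C_0=C_1=0$, $C_2=d$ and, for all $n\ge 3$, $$C_n=\sum_{1\le p<q\le n}\frac{2}{n(n-1)}\Bigl(a(n+1)+b+C_{p-1}+C_{q-p-1}+C_{n-q}\Bigr),$$ equivalently $C_n=a(n+1)+b+\frac{6}{n(n-1)}\sum_{k=0}^{n-2}(n-k-1)C_k$. Then for all $n\ge 4$, $$C_n=\tfrac{6}{5}a\,(n+1)\Bigl(\mathcal{H}_{n+1}-\tfrac{1}{5}\Bigr)+\Bigl(-\tfrac{3}{2}a+\tfrac{3}{10}b+\tfrac{1}{10}d\Bigr)(n+1)-\tfrac{1}{2}b .$$
   Context: $\mathcal{H}_m=\sum_{i=1}^m \frac1i$ denotes the $m$-th harmonic number. (This recurrence describes the expected cost of a dual-pivot Quicksort on a uniformly random permutation of length $n$ whose expected partitioning cost is $a(n+1)+b$ and whose cost on length-2 inputs is $d$.)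
   Formalization: The constants $a,b,d$ are rational rather than real. -}

module Defs where

open import Data.Nat as ℕ using (ℕ; zero; suc; _∸_; _≤?_)
open import Data.Integer using (+_)
open import Data.Rational using (ℚ; 0ℚ; _+_; _*_; _-_; _/_)
open import Data.Bool using (if_then_else_)
open import Relation.Nullary using (does)

ℕ→ℚ : ℕ → ℚ
ℕ→ℚ n = + n / 1

sumTo : ℕ → (ℕ → ℚ) → ℚ
sumTo zero    f = 0ℚ
sumTo (suc n) f = f n + sumTo n f

-- sumFromTo lo hi f = Σ_{lo ≤ i ≤ hi} f i  (empty if hi < lo)
sumFromTo : ℕ → ℕ → (ℕ → ℚ) → ℚ
sumFromTo lo hi f = sumTo (suc hi ∸ lo) (λ i → f (lo ℕ.+ i))

H : ℕ → ℚ
H m = sumTo m (λ j → + 1 / suc j)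

-- the value C_m computed from f, where f k = C_k for all k < m
step : ℚ → ℚ → ℚ → (m : ℕ) → (ℕ → ℚ) → ℚ
step a b d zero f = 0ℚ
step a b d (suc zero) f = 0ℚ
step a b d (suc (suc zero)) f = d
step a b d m@(suc (suc (suc j))) f =
  sumFromTo 1 m (λ q → sumFromTo 1 (q ∸ 1) (λ p →
    (+ 2 / (m ℕ.* (m ∸ 1))) *
      (a * ℕ→ℚ (suc m) + b + f (p ∸ 1) + f (q ∸ p ∸ 1) + f (m ∸ q))))

table : ℚ → ℚ → ℚ → ℕ → (ℕ → ℚ)
table a b d zero k = step a b d zero (λ _ → 0ℚ)
table a b d (suc n) k =
  if does (k ≤? n) then table a b d n k else step a b d (suc n) (table a b d n)

C : ℚ → ℚ → ℚ → ℕ → ℚ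
C a b d n = table a b d n n

-- Write T n = Σ_{k<n} C k and U n = Σ_{k<n} T k = Σ_{k<n} (n-1-k) C k.  In the defining
-- double sum over pivot pairs, each of the three subproblem costs sums to U n (the middle one
-- after reversing the inner sum, the last one after exchanging the order of summation), so
-- C n = a(n+1) + b + 6 U n / (n(n-1)) for n ≥ 3.  From n = 4 on (the base case uses
-- C 3 = 4a + b), T n and U n are explicit polynomials in n and H n: the induction steps
-- T (n+1) = C n + T n and U (n+1) = T n + U n, as well as the final rewriting of C n, are
-- polynomial identities once (n+1) H (n+1) is replaced by (n+1) H n + 1.

module Submission where

open import Defs
open import Data.Nat using (ℕ; suc; _≤_)
open import Data.Integer using (+_; -[1+_])
open import Data.Rational using (ℚ; _+_; _*_; _-_; _/_)
open import Relation.Binary.PropositionalEquality using (_≡_)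

open import Algebra.Bundles using (CommutativeMonoid)
open import Algebra.Bundles.Raw using (RawRing)
open import Data.Nat as ℕ using (zero; _<_; _∸_; z≤n; s≤s; _≤?_)
import Data.Nat.Properties as ℕ
import Data.Integer as ℤ
import Data.Integer.Properties as ℤ
open import Data.Product using (_×_; _,_; proj₂)
open import Data.Sum using (inj₁; inj₂)
open import Data.Bool using (if_then_else_)
open import Function using (_∘_)
open import Data.Rational using (0ℚ; 1ℚ; ½; toℚᵘ; +-*-rawRing)
open import Data.Rational.Properties as ℚ
  using (toℚᵘ-injective; toℚᵘ-fromℚᵘ; toℚᵘ-homo-+; toℚᵘ-homo-*)
open import Data.Rational.Solver using (module +-*-Solver)
open import Data.Rational.Unnormalised as ℚᵘ using (mkℚᵘ; *≡*)
import Data.Rational.Unnormalised.Properties as ℚᵘ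
open import Algebra.Properties.CommutativeSemigroup
  (CommutativeMonoid.commutativeSemigroup ℚ.+-0-commutativeMonoid) using (interchange)
open import Algebra.Properties.Group ℚ.+-0-group using (∙-cancelʳ)
open import Relation.Binary.PropositionalEquality using (refl; sym; trans; cong; cong₂; module ≡-Reasoning)
open import Relation.Nullary.Decidable using (dec-true; dec-false)
open import Level using (0ℓ)

open +-*-Solver

toℚᵘ-/ : ∀ i k → toℚᵘ (i / suc k) ℚᵘ.≃ mkℚᵘ i k
toℚᵘ-/ i k = toℚᵘ-fromℚᵘ (mkℚᵘ i k)

/1-homo-+ : ∀ i j → (i ℤ.+ j) / 1 ≡ i / 1 + j / 1
/1-homo-+ i j = toℚᵘ-injective (begin
  toℚᵘ ((i ℤ.+ j) / 1)                ≈⟨ toℚᵘ-/ (i ℤ.+ j) 0 ⟩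
  mkℚᵘ (i ℤ.+ j) 0                    ≈⟨ *≡* (cong (ℤ._* + 1) (sym (cong₂ ℤ._+_ (ℤ.*-identityʳ i) (ℤ.*-identityʳ j)))) ⟩
  mkℚᵘ i 0 ℚᵘ.+ mkℚᵘ j 0              ≈⟨ ℚᵘ.+-cong (toℚᵘ-/ i 0) (toℚᵘ-/ j 0) ⟨
  toℚᵘ (i / 1) ℚᵘ.+ toℚᵘ (j / 1)      ≈⟨ toℚᵘ-homo-+ (i / 1) (j / 1) ⟨
  toℚᵘ (i / 1 + j / 1)                ∎)
  where open ℚᵘ.≃-Reasoning

/1-homo-* : ∀ i j → (i ℤ.* j) / 1 ≡ (i / 1) * (j / 1)
/1-homo-* i j = toℚᵘ-injective (begin
  toℚᵘ ((i ℤ.* j) / 1)                ≈⟨ toℚᵘ-/ (i ℤ.* j) 0 ⟩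
  mkℚᵘ (i ℤ.* j) 0                    ≈⟨ *≡* refl ⟩
  mkℚᵘ i 0 ℚᵘ.* mkℚᵘ j 0              ≈⟨ ℚᵘ.*-cong (toℚᵘ-/ i 0) (toℚᵘ-/ j 0) ⟨
  toℚᵘ (i / 1) ℚᵘ.* toℚᵘ (j / 1)      ≈⟨ toℚᵘ-homo-* (i / 1) (j / 1) ⟨
  toℚᵘ ((i / 1) * (j / 1))            ∎)
  where open ℚᵘ.≃-Reasoning

ℕ→ℚ-homo-+ : ∀ m n → ℕ→ℚ (m ℕ.+ n) ≡ ℕ→ℚ m + ℕ→ℚ n
ℕ→ℚ-homo-+ m n = trans (cong (_/ 1) (ℤ.pos-+ m n)) (/1-homo-+ (+ m) (+ n))

ℕ→ℚ-homo-* : ∀ m n → ℕ→ℚ (m ℕ.* n) ≡ ℕ→ℚ m * ℕ→ℚ n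
ℕ→ℚ-homo-* m n = trans (cong (_/ 1) (ℤ.pos-* m n)) (/1-homo-* (+ m) (+ n))

ℕ→ℚ-suc : ∀ n → ℕ→ℚ (suc n) ≡ ℕ→ℚ n + 1ℚ
ℕ→ℚ-suc n = trans (cong ℕ→ℚ (ℕ.+-comm 1 n)) (ℕ→ℚ-homo-+ n 1)

ℕ→ℚ-*-/ : ∀ i n .{{_ : ℕ.NonZero n}} → ℕ→ℚ n * (i / n) ≡ i / 1
ℕ→ℚ-*-/ i (suc k) = toℚᵘ-injective (begin
  toℚᵘ (ℕ→ℚ (suc k) * (i / suc k))            ≈⟨ toℚᵘ-homo-* (ℕ→ℚ (suc k)) (i / suc k) ⟩
  toℚᵘ (ℕ→ℚ (suc k)) ℚᵘ.* toℚᵘ (i / suc k)    ≈⟨ ℚᵘ.*-cong (toℚᵘ-/ (+ suc k) 0) (toℚᵘ-/ i k) ⟩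
  mkℚᵘ (+ suc k) 0 ℚᵘ.* mkℚᵘ i k              ≈⟨ *≡* cross ⟩
  mkℚᵘ i 0                                    ≈⟨ toℚᵘ-/ i 0 ⟨
  toℚᵘ (i / 1)                                ∎)
  where
  open ℚᵘ.≃-Reasoning
  cross : (+ suc k ℤ.* i) ℤ.* + 1 ≡ i ℤ.* + (1 ℕ.* suc k)
  cross = trans (ℤ.*-identityʳ _)
    (trans (ℤ.*-comm (+ suc k) i) (cong (λ n → i ℤ.* + n) (sym (ℕ.*-identityˡ (suc k)))))

H-suc-scaled : ∀ n → (ℕ→ℚ n + 1ℚ) * H (suc n) ≡ (ℕ→ℚ n + 1ℚ) * H n + 1ℚ
H-suc-scaled n = begin
  (ℕ→ℚ n + 1ℚ) * (+ 1 / suc n + H n)               ≡⟨ ℚ.*-distribˡ-+ (ℕ→ℚ n + 1ℚ) (+ 1 / suc n) (H n) ⟩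
  (ℕ→ℚ n + 1ℚ) * (+ 1 / suc n) + (ℕ→ℚ n + 1ℚ) * H n ≡⟨ cong (λ x → x * (+ 1 / suc n) + x * H n) (ℕ→ℚ-suc n) ⟨
  ℕ→ℚ (suc n) * (+ 1 / suc n) + ℕ→ℚ (suc n) * H n   ≡⟨ cong (_+ ℕ→ℚ (suc n) * H n) (ℕ→ℚ-*-/ (+ 1) (suc n)) ⟩
  1ℚ + ℕ→ℚ (suc n) * H n                             ≡⟨ ℚ.+-comm 1ℚ (ℕ→ℚ (suc n) * H n) ⟩
  ℕ→ℚ (suc n) * H n + 1ℚ                             ≡⟨ cong (λ x → x * H n + 1ℚ) (ℕ→ℚ-suc n) ⟩
  (ℕ→ℚ n + 1ℚ) * H n + 1ℚ                            ∎
  where open ≡-Reasoning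

sumTo-cong : ∀ n {f g : ℕ → ℚ} → (∀ {i} → i < n → f i ≡ g i) → sumTo n f ≡ sumTo n g
sumTo-cong zero    f≗g = refl
sumTo-cong (suc n) f≗g = cong₂ _+_ (f≗g (ℕ.n<1+n n)) (sumTo-cong n (f≗g ∘ ℕ.m<n⇒m<1+n))

sumTo-+ : ∀ n (f g : ℕ → ℚ) → sumTo n (λ i → f i + g i) ≡ sumTo n f + sumTo n g
sumTo-+ zero    f g = refl
sumTo-+ (suc n) f g = trans (cong (λ s → f n + g n + s) (sumTo-+ n f g))
  (interchange (f n) (g n) (sumTo n f) (sumTo n g))

sumTo-*ˡ : ∀ n c (f : ℕ → ℚ) → sumTo n (λ i → c * f i) ≡ c * sumTo n f
sumTo-*ˡ zero    c f = sym (ℚ.*-zeroʳ c)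
sumTo-*ˡ (suc n) c f = trans (cong (λ s → c * f n + s) (sumTo-*ˡ n c f))
  (sym (ℚ.*-distribˡ-+ c (f n) (sumTo n f)))

sumTo-const : ∀ n c → sumTo n (λ _ → c) ≡ c * ℕ→ℚ n
sumTo-const zero    c = sym (ℚ.*-zeroʳ c)
sumTo-const (suc n) c = begin
  c + sumTo n (λ _ → c)     ≡⟨ cong₂ _+_ (sym (ℚ.*-identityʳ c)) (sumTo-const n c) ⟩
  c * 1ℚ + c * ℕ→ℚ n        ≡⟨ ℚ.*-distribˡ-+ c 1ℚ (ℕ→ℚ n) ⟨
  c * (1ℚ + ℕ→ℚ n)          ≡⟨ cong (c *_) (ℕ→ℚ-homo-+ 1 n) ⟨
  c * ℕ→ℚ (suc n)           ∎
  where open ≡-Reasoning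

sumTo-suc-shift : ∀ n (f : ℕ → ℚ) → sumTo (suc n) f ≡ sumTo n (f ∘ suc) + f 0
sumTo-suc-shift zero    f = trans (ℚ.+-identityʳ (f 0)) (sym (ℚ.+-identityˡ (f 0)))
sumTo-suc-shift (suc n) f = trans (cong (λ s → f (suc n) + s) (sumTo-suc-shift n f))
  (sym (ℚ.+-assoc (f (suc n)) (sumTo n (f ∘ suc)) (f 0)))

sumTo-reverse : ∀ n (f : ℕ → ℚ) → sumTo n (λ i → f (n ∸ suc i)) ≡ sumTo n f
sumTo-reverse zero    f = refl
sumTo-reverse (suc n) f = begin
  sumTo (suc n) (λ i → f (n ∸ i))          ≡⟨ sumTo-suc-shift n (λ i → f (n ∸ i)) ⟩
  sumTo n (λ i → f (n ∸ suc i)) + f n      ≡⟨ cong (_+ f n) (sumTo-reverse n f) ⟩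
  sumTo n f + f n                          ≡⟨ ℚ.+-comm (sumTo n f) (f n) ⟩
  f n + sumTo n f                          ∎
  where open ≡-Reasoning

sumTo-ℕ→ℚ : ∀ n → sumTo (suc n) ℕ→ℚ ≡ ½ * ℕ→ℚ (suc n) * ℕ→ℚ n
sumTo-ℕ→ℚ zero    = refl
sumTo-ℕ→ℚ (suc n) = begin
  ℕ→ℚ (suc n) + sumTo (suc n) ℕ→ℚ           ≡⟨ cong (λ s → ℕ→ℚ (suc n) + s) (sumTo-ℕ→ℚ n) ⟩
  ℕ→ℚ (suc n) + ½ * ℕ→ℚ (suc n) * ℕ→ℚ n     ≡⟨ cong (λ x → x + ½ * x * ℕ→ℚ n) (ℕ→ℚ-suc n) ⟩
  x + 1ℚ + ½ * (x + 1ℚ) * x                 ≡⟨ solve 1 (λ x → x :+ con 1ℚ :+ con ½ :* (x :+ con 1ℚ) :* x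
                                                           := con ½ :* (x :+ con 1ℚ :+ con 1ℚ) :* (x :+ con 1ℚ)) refl x ⟩
  ½ * (x + 1ℚ + 1ℚ) * (x + 1ℚ)              ≡⟨ cong (λ y → ½ * (y + 1ℚ) * y) (ℕ→ℚ-suc n) ⟨
  ½ * (ℕ→ℚ (suc n) + 1ℚ) * ℕ→ℚ (suc n)      ≡⟨ cong (λ y → ½ * y * ℕ→ℚ (suc n)) (ℕ→ℚ-suc (suc n)) ⟨
  ½ * ℕ→ℚ (suc (suc n)) * ℕ→ℚ (suc n)       ∎
  where open ≡-Reasoning; x = ℕ→ℚ n

sumOfPartialSums : (ℕ → ℚ) → ℕ → ℚ
sumOfPartialSums f m = sumTo m (λ i → sumTo i f)

sumOfPartialSums-cong : ∀ m {f g : ℕ → ℚ} → (∀ {k} → k < m → f k ≡ g k) →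
  sumOfPartialSums f m ≡ sumOfPartialSums g m
sumOfPartialSums-cong m f≗g = sumTo-cong m (λ i<m → sumTo-cong _ (λ k<i → f≗g (ℕ.<-trans k<i i<m)))

sumTo-weighted-reverse : ∀ m (f : ℕ → ℚ) →
  sumTo m (λ i → ℕ→ℚ i * f (m ∸ suc i)) ≡ sumOfPartialSums f m
sumTo-weighted-reverse zero    f = refl
sumTo-weighted-reverse (suc m) f = begin
  sumTo (suc m) (λ i → ℕ→ℚ i * f (m ∸ i))
    ≡⟨ sumTo-suc-shift m (λ i → ℕ→ℚ i * f (m ∸ i)) ⟩
  sumTo m (λ i → ℕ→ℚ (suc i) * g i) + 0ℚ * f m
    ≡⟨ cong₂ _+_ (sumTo-cong m (λ {i} _ → unfold i)) (ℚ.*-zeroˡ (f m)) ⟩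
  sumTo m (λ i → g i + ℕ→ℚ i * g i) + 0ℚ
    ≡⟨ ℚ.+-identityʳ _ ⟩
  sumTo m (λ i → g i + ℕ→ℚ i * g i)
    ≡⟨ sumTo-+ m g (λ i → ℕ→ℚ i * g i) ⟩
  sumTo m g + sumTo m (λ i → ℕ→ℚ i * g i)
    ≡⟨ cong₂ _+_ (sumTo-reverse m f) (sumTo-weighted-reverse m f) ⟩
  sumTo m f + sumOfPartialSums f m
    ∎
  where
  open ≡-Reasoning
  g : ℕ → ℚ
  g i = f (m ∸ suc i)
  unfold : ∀ i → ℕ→ℚ (suc i) * g i ≡ g i + ℕ→ℚ i * g i
  unfold i = begin
    ℕ→ℚ (suc i) * g i           ≡⟨ cong (_* g i) (ℕ→ℚ-homo-+ 1 i) ⟩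
    (1ℚ + ℕ→ℚ i) * g i          ≡⟨ ℚ.*-distribʳ-+ (g i) 1ℚ (ℕ→ℚ i) ⟩
    1ℚ * g i + ℕ→ℚ i * g i      ≡⟨ cong (_+ ℕ→ℚ i * g i) (ℚ.*-identityˡ (g i)) ⟩
    g i + ℕ→ℚ i * g i           ∎

-- In step, i = q - 1 and k = p - 1 for the pivot positions p < q; the three subproblems then
-- have sizes k, i ∸ k ∸ 1 and m ∸ suc i.
sumTo-splits : ∀ m A (f : ℕ → ℚ) →
  sumTo m (λ i → sumTo i (λ k → A + f k + f (i ∸ k ∸ 1) + f (m ∸ suc i)))
    ≡ A * sumTo m ℕ→ℚ + (sumOfPartialSums f m + sumOfPartialSums f m + sumOfPartialSums f m)
sumTo-splits m A f = begin
  sumTo m (λ i → sumTo i (λ k → A + f k + f (i ∸ k ∸ 1) + f (m ∸ suc i)))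
    ≡⟨ sumTo-cong m (λ {i} _ → inner i) ⟩
  sumTo m (λ i → A * ℕ→ℚ i + sumTo i f + sumTo i f + ℕ→ℚ i * f (m ∸ suc i))
    ≡⟨ sumTo-+ m (λ i → A * ℕ→ℚ i + sumTo i f + sumTo i f) (λ i → ℕ→ℚ i * f (m ∸ suc i)) ⟩
  sumTo m (λ i → A * ℕ→ℚ i + sumTo i f + sumTo i f) + sumTo m (λ i → ℕ→ℚ i * f (m ∸ suc i))
    ≡⟨ cong₂ _+_ (sumTo-+ m (λ i → A * ℕ→ℚ i + sumTo i f) (λ i → sumTo i f))
                 (sumTo-weighted-reverse m f) ⟩
  sumTo m (λ i → A * ℕ→ℚ i + sumTo i f) + S + S
    ≡⟨ cong (λ s → s + S + S) (trans (sumTo-+ m (λ i → A * ℕ→ℚ i) (λ i → sumTo i f))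
                                     (cong (_+ S) (sumTo-*ˡ m A ℕ→ℚ))) ⟩
  A * sumTo m ℕ→ℚ + S + S + S
    ≡⟨ solve 4 (λ x s₁ s₂ s₃ → x :+ s₁ :+ s₂ :+ s₃ := x :+ (s₁ :+ s₂ :+ s₃)) refl (A * sumTo m ℕ→ℚ) S S S ⟩
  A * sumTo m ℕ→ℚ + (S + S + S)
    ∎
  where
  open ≡-Reasoning
  S = sumOfPartialSums f m
  inner : ∀ i → sumTo i (λ k → A + f k + f (i ∸ k ∸ 1) + f (m ∸ suc i))
              ≡ A * ℕ→ℚ i + sumTo i f + sumTo i f + ℕ→ℚ i * f (m ∸ suc i)
  inner i = begin
    sumTo i (λ k → A + f k + f (i ∸ k ∸ 1) + B)
      ≡⟨ sumTo-+ i (λ k → A + f k + f (i ∸ k ∸ 1)) (λ _ → B) ⟩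
    sumTo i (λ k → A + f k + f (i ∸ k ∸ 1)) + sumTo i (λ _ → B)
      ≡⟨ cong₂ _+_ (sumTo-+ i (λ k → A + f k) (λ k → f (i ∸ k ∸ 1))) (sumTo-const i B) ⟩
    sumTo i (λ k → A + f k) + sumTo i (λ k → f (i ∸ k ∸ 1)) + B * ℕ→ℚ i
      ≡⟨ cong₂ (λ s t → s + t + B * ℕ→ℚ i)
               (trans (sumTo-+ i (λ _ → A) f) (cong (_+ sumTo i f) (sumTo-const i A)))
               (trans (sumTo-cong i (λ {k} _ → cong f (∸-∸-1 i k))) (sumTo-reverse i f)) ⟩
    A * ℕ→ℚ i + sumTo i f + sumTo i f + B * ℕ→ℚ i
      ≡⟨ cong (λ s → A * ℕ→ℚ i + sumTo i f + sumTo i f + s) (ℚ.*-comm B (ℕ→ℚ i)) ⟩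
    A * ℕ→ℚ i + sumTo i f + sumTo i f + ℕ→ℚ i * B
      ∎
    where
    B = f (m ∸ suc i)
    ∸-∸-1 : ∀ i k → i ∸ k ∸ 1 ≡ i ∸ suc k
    ∸-∸-1 i k = trans (ℕ.∸-+-assoc i k 1) (cong (i ∸_) (ℕ.+-comm k 1))

module _ (a b d : ℚ) where

  table-agrees : ∀ n {k} → k ≤ n → table a b d n k ≡ C a b d k
  table-agrees zero    z≤n = refl
  table-agrees (suc n) {k} k≤1+n with ℕ.m≤n⇒m<n∨m≡n k≤1+n
  ... | inj₂ refl = refl
  ... | inj₁ k<1+n = trans
    (cong (λ c → if c then table a b d n k else step a b d (suc n) (table a b d n))
          (dec-true (k ≤? n) (ℕ.≤-pred k<1+n)))
    (table-agrees n (ℕ.≤-pred k<1+n))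

  C-suc : ∀ n → C a b d (suc n) ≡ step a b d (suc n) (table a b d n)
  C-suc n = cong (λ c → if c then table a b d n (suc n) else step a b d (suc n) (table a b d n))
                 (dec-false (suc n ≤? n) (ℕ.n≮n n))

  step-≥3 : ∀ j (f : ℕ → ℚ) → let m = 3 ℕ.+ j; w = + 2 / (m ℕ.* (m ∸ 1)) in
    step a b d m f ≡
      w * ((a * ℕ→ℚ (suc m) + b) * sumTo m ℕ→ℚ
           + (sumOfPartialSums f m + sumOfPartialSums f m + sumOfPartialSums f m))
  step-≥3 j f = begin
    sumTo m (λ i → sumTo i (λ k → w * F i k))  ≡⟨ sumTo-cong m (λ {i} _ → sumTo-*ˡ i w (F i)) ⟩
    sumTo m (λ i → w * sumTo i (F i))          ≡⟨ sumTo-*ˡ m w (λ i → sumTo i (F i)) ⟩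
    w * sumTo m (λ i → sumTo i (F i))          ≡⟨ cong (w *_) (sumTo-splits m (a * ℕ→ℚ (suc m) + b) f) ⟩
    _                                          ∎
    where
    open ≡-Reasoning
    m = 3 ℕ.+ j
    w = + 2 / (m ℕ.* (m ∸ 1))
    F : ℕ → ℕ → ℚ
    F i k = a * ℕ→ℚ (suc m) + b + f k + f (i ∸ k ∸ 1) + f (m ∸ suc i)

  C-recurrence : ∀ j → let m = 3 ℕ.+ j; w = + 2 / (m ℕ.* (m ∸ 1)); U = sumOfPartialSums (C a b d) m in
    C a b d m ≡ w * ((a * ℕ→ℚ (suc m) + b) * sumTo m ℕ→ℚ + (U + U + U))
  C-recurrence j = trans (C-suc (2 ℕ.+ j)) (trans (step-≥3 j _)
    (cong (λ U → w * ((a * ℕ→ℚ (suc m) + b) * sumTo m ℕ→ℚ + (U + U + U)))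
          (sumOfPartialSums-cong m (λ k<m → table-agrees (2 ℕ.+ j) (ℕ.≤-pred k<m)))))
    where m = 3 ℕ.+ j; w = + 2 / (m ℕ.* (m ∸ 1))

polynomialRawRing : ℕ → RawRing 0ℓ 0ℓ
polynomialRawRing n = record
  { Carrier = Polynomial n
  ; _≈_     = _≡_
  ; _+_     = _:+_
  ; _*_     = _:*_
  ; -_      = :-_
  ; 0#      = con 0ℚ
  ; 1#      = con 1ℚ
  }

-- Stated over any raw ring with rational constants, so that the same expressions are both
-- functions on ℚ and syntax for the ring solver.  For n ≥ 4, with x = n and h = H n, t, u and c
-- are the values of Σ_{k<n} C_k, Σ_{k<n} (n-1-k) C_k and C_n, and u = n(n-1) v.
module ClosedForms (R : RawRing 0ℓ 0ℓ) (κ : ℚ → RawRing.Carrier R) (a b d : RawRing.Carrier R) where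
  open RawRing R renaming (_+_ to _⊕_; _*_ to _⊗_; -_ to ⊖_)

  infixl 6 _⊝_
  _⊝_ : Carrier → Carrier → Carrier
  x ⊝ y = x ⊕ ⊖ y

  v t u c paperForm : Carrier → Carrier → Carrier
  v x h = a ⊗ (κ (+ 1 / 5) ⊗ (x ⊕ 1#) ⊗ h ⊝ κ (+ 137 / 300) ⊗ x ⊝ κ (+ 77 / 300))
        ⊕ b ⊗ (κ (+ 1 / 20) ⊗ x ⊝ κ (+ 1 / 5)) ⊕ d ⊗ (κ (+ 1 / 60) ⊗ (x ⊕ 1#))
  t x h = a ⊗ (κ (+ 3 / 5) ⊗ x ⊗ (x ⊕ 1#) ⊗ h ⊝ κ (+ 117 / 100) ⊗ x ⊗ x ⊝ κ (+ 57 / 100) ⊗ x)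
        ⊕ b ⊗ (κ (+ 3 / 20) ⊗ x ⊗ x ⊝ κ (+ 7 / 20) ⊗ x) ⊕ d ⊗ (κ (+ 1 / 20) ⊗ x ⊗ (x ⊕ 1#))
  u x h = x ⊗ (x ⊝ 1#) ⊗ v x h
  c x h = a ⊗ (x ⊕ 1#) ⊕ b ⊕ κ (+ 6 / 1) ⊗ v x h
  paperForm z h = κ (+ 6 / 5) ⊗ a ⊗ z ⊗ (h ⊝ κ (+ 1 / 5))
                ⊕ (κ (-[1+ 2 ] / 2) ⊗ a ⊕ κ (+ 3 / 10) ⊗ b ⊕ κ (+ 1 / 10) ⊗ d) ⊗ z ⊝ κ (+ 1 / 2) ⊗ b

module Syntax {n} = ClosedForms (polynomialRawRing n) con

≡-modulo : ∀ {L R} P {w₁ w₂ : ℚ} → w₁ ≡ w₂ → L + P * w₂ ≡ R + P * w₁ → L ≡ R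
≡-modulo {L} {R} P {w₁} refl = ∙-cancelʳ (P * w₁) L R

HarmonicShift : (ℚ → ℚ → ℚ) → (ℚ → ℚ → ℚ) → Set
HarmonicShift F G = ∀ x h h′ → (x + 1ℚ) * h′ ≡ (x + 1ℚ) * h + 1ℚ → F (x + 1ℚ) h′ ≡ G x h

HarmonicShift-at : ∀ {F G} → HarmonicShift F G → ∀ n → F (ℕ→ℚ (suc n)) (H (suc n)) ≡ G (ℕ→ℚ n) (H n)
HarmonicShift-at {F} shift n =
  trans (cong (λ x → F x (H (suc n))) (ℕ→ℚ-suc n)) (shift (ℕ→ℚ n) (H n) (H (suc n)) (H-suc-scaled n))

module _ (a b d : ℚ) where
  module Closed = ClosedForms +-*-rawRing (λ q → q) a b d

  -- The multiplier handed to ≡-modulo is the coefficient of the constrained product.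
  t-shift : HarmonicShift Closed.t (λ x h → Closed.c x h + Closed.t x h)
  t-shift x h h′ eq = ≡-modulo ((+ 3 / 5) * a * (x + + 2 / 1)) eq (solve 6 (λ a b d x h h′ →
    let open Syntax a b d; P = con (+ 3 / 5) :* a :* (x :+ con (+ 2 / 1)) in
    t (x :+ con 1ℚ) h′ :+ P :* ((x :+ con 1ℚ) :* h :+ con 1ℚ)
      := c x h :+ t x h :+ P :* ((x :+ con 1ℚ) :* h′))
    refl a b d x h h′)

  u-shift : HarmonicShift Closed.u (λ x h → Closed.t x h + Closed.u x h)
  u-shift x h h′ eq = ≡-modulo ((+ 1 / 5) * a * x * (x + + 2 / 1)) eq (solve 6 (λ a b d x h h′ →
    let open Syntax a b d; P = con (+ 1 / 5) :* a :* x :* (x :+ con (+ 2 / 1)) in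
    u (x :+ con 1ℚ) h′ :+ P :* ((x :+ con 1ℚ) :* h :+ con 1ℚ)
      := t x h :+ u x h :+ P :* ((x :+ con 1ℚ) :* h′))
    refl a b d x h h′)

  paperForm-shift : HarmonicShift Closed.paperForm Closed.c
  paperForm-shift x h h′ eq = ≡-modulo ((+ 6 / 5) * a) eq (solve 6 (λ a b d x h h′ →
    let open Syntax a b d; P = con (+ 6 / 5) :* a in
    paperForm (x :+ con 1ℚ) h′ :+ P :* ((x :+ con 1ℚ) :* h :+ con 1ℚ)
      := c x h :+ P :* ((x :+ con 1ℚ) :* h′))
    refl a b d x h h′)

  c-recurrence : ∀ w x y h → x ≡ y + 1ℚ → w * (x * y) ≡ + 2 / 1 →
    w * ((a * (x + 1ℚ) + b) * (½ * x * y) + (Closed.u x h + Closed.u x h + Closed.u x h)) ≡ Closed.c x h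
  c-recurrence w _ y h refl eq = ≡-modulo ((a * (y + 1ℚ + 1ℚ) + b) * ½ + (+ 3 / 1) * Closed.v (y + 1ℚ) h) eq
    (solve 6 (λ a b d w y h →
      let open Syntax a b d; x = y :+ con 1ℚ; U = u x h
          P = (a :* (x :+ con 1ℚ) :+ b) :* con ½ :+ con (+ 3 / 1) :* v x h in
      w :* ((a :* (x :+ con 1ℚ) :+ b) :* (con ½ :* x :* y) :+ (U :+ U :+ U)) :+ P :* con (+ 2 / 1)
        := c x h :+ P :* (w :* (x :* y)))
    refl a b d w y h)

  PartialSumsClosed : ℕ → Set
  PartialSumsClosed n = sumTo n (C a b d) ≡ Closed.t (ℕ→ℚ n) (H n)
                      × sumOfPartialSums (C a b d) n ≡ Closed.u (ℕ→ℚ n) (H n)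

  C-closed : ∀ j → let m = 3 ℕ.+ j in
    sumOfPartialSums (C a b d) m ≡ Closed.u (ℕ→ℚ m) (H m) → C a b d m ≡ Closed.c (ℕ→ℚ m) (H m)
  C-closed j U≡u = begin
    C a b d m
      ≡⟨ C-recurrence a b d j ⟩
    w * ((a * ℕ→ℚ (suc m) + b) * sumTo m ℕ→ℚ + (U + U + U))
      ≡⟨ cong₂ (λ z s → w * ((a * z + b) * s + (U + U + U))) (ℕ→ℚ-suc m) (sumTo-ℕ→ℚ (2 ℕ.+ j)) ⟩
    w * ((a * (x + 1ℚ) + b) * (½ * x * y) + (U + U + U))
      ≡⟨ cong (λ U → w * ((a * (x + 1ℚ) + b) * (½ * x * y) + (U + U + U))) U≡u ⟩
    w * ((a * (x + 1ℚ) + b) * (½ * x * y) + (Closed.u x h + Closed.u x h + Closed.u x h))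
      ≡⟨ c-recurrence w x y h (ℕ→ℚ-suc (2 ℕ.+ j)) w[xy]≡2 ⟩
    Closed.c x h
      ∎
    where
    open ≡-Reasoning
    m = 3 ℕ.+ j
    w = + 2 / (m ℕ.* (m ∸ 1))
    U = sumOfPartialSums (C a b d) m
    x = ℕ→ℚ m
    y = ℕ→ℚ (2 ℕ.+ j)
    h = H m
    w[xy]≡2 : w * (x * y) ≡ + 2 / 1
    w[xy]≡2 = begin
      w * (x * y)                  ≡⟨ cong (w *_) (ℕ→ℚ-homo-* m (2 ℕ.+ j)) ⟨
      w * ℕ→ℚ (m ℕ.* (m ∸ 1))      ≡⟨ ℚ.*-comm w _ ⟩
      ℕ→ℚ (m ℕ.* (m ∸ 1)) * w      ≡⟨ ℕ→ℚ-*-/ (+ 2) (m ℕ.* (m ∸ 1)) ⟩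
      + 2 / 1                      ∎

  C-3 : C a b d 3 ≡ a * ℕ→ℚ 4 + b
  C-3 = trans (C-recurrence a b d 0) (solve 2 (λ a b →
    con (+ 2 / 6) :* ((a :* con (ℕ→ℚ 4) :+ b) :* con (sumTo 3 ℕ→ℚ) :+ (con 0ℚ :+ con 0ℚ :+ con 0ℚ))
      := a :* con (ℕ→ℚ 4) :+ b) refl a b)

  partialSumsClosed-4 : PartialSumsClosed 4
  partialSumsClosed-4 =
    trans (cong (_+ (d + 0ℚ)) C-3) (solve 3 (λ a b d → let open Syntax a b d in
      a :* con (ℕ→ℚ 4) :+ b :+ (d :+ con 0ℚ) := t (con (ℕ→ℚ 4)) (con (H 4))) refl a b d) ,
    solve 3 (λ a b d → let open Syntax a b d in
      d :+ con 0ℚ :+ con 0ℚ := u (con (ℕ→ℚ 4)) (con (H 4))) refl a b d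

  partialSumsClosed-suc : ∀ j → PartialSumsClosed (3 ℕ.+ j) → PartialSumsClosed (4 ℕ.+ j)
  partialSumsClosed-suc j (T≡t , U≡u) =
    trans (cong₂ _+_ (C-closed j U≡u) T≡t) (sym (HarmonicShift-at {Closed.t} t-shift (3 ℕ.+ j))) ,
    trans (cong₂ _+_ T≡t U≡u) (sym (HarmonicShift-at {Closed.u} u-shift (3 ℕ.+ j)))

  partialSumsClosed : ∀ k → PartialSumsClosed (4 ℕ.+ k)
  partialSumsClosed zero    = partialSumsClosed-4
  partialSumsClosed (suc k) = partialSumsClosed-suc (suc k) (partialSumsClosed k)

  C-paperForm : ∀ k → let n = 4 ℕ.+ k in C a b d n ≡ Closed.paperForm (ℕ→ℚ (suc n)) (H (suc n))
  C-paperForm k = trans (C-closed (suc k) (proj₂ (partialSumsClosed k)))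
                        (sym (HarmonicShift-at {Closed.paperForm} paperForm-shift (4 ℕ.+ k)))

mainTheorem1 : (a b d : ℚ) (n : ℕ) → 4 ≤ n →
    C a b d n ≡
      (+ 6 / 5) * a * ℕ→ℚ (suc n) * (H (suc n) - + 1 / 5)
      + ((-[1+ 2 ] / 2) * a + (+ 3 / 10) * b + (+ 1 / 10) * d) * ℕ→ℚ (suc n)
      - (+ 1 / 2) * b
mainTheorem1 a b d _ (s≤s (s≤s (s≤s (s≤s {n = k} z≤n)))) = C-paperForm a b d k
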